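{- For $m\in\{2,-2\}$ define integers $c_m(n)$ by $$\frac{1}{(1-x)^{m}}\prod_{i=0}^{\infty}\frac{1}{(1-x^{2^{i}})^{m}}=\sum_{n=0}^{\infty}c_{m}(n)x^{n}.$$ Then for every integer $n\ge 1$ we have $c_{\pm 2}(n)\equiv 4\pmod 8$; consequently $\nu_2(c_{\pm2}(n))=2$ for all $n\ge1$.
   Context: $\nu_2(a)$ is the $2$-adic valuation of the integer $a$. -}

module Defs where

open import Data.Nat as ℕ using (ℕ; zero; suc; _^_)
open import Data.Nat.Divisibility using (_∣?_)
open import Data.Integer using (ℤ; +_; -[1+_]; _+_; _*_; -_; 0ℤ; 1ℤ)
open import Data.Integer.Divisibility using (_∣_)
open import Data.Product using (_×_)
open import Relation.Nullary using (¬_)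
open import Relation.Nullary.Decidable using (does)
open import Data.Bool using (if_then_else_)

Series : Set
Series = ℕ → ℤ

Σ≤ : ℕ → (ℕ → ℤ) → ℤ
Σ≤ zero    f = f zero
Σ≤ (suc n) f = Σ≤ n f + f (suc n)

_⊛_ : Series → Series → Series
(f ⊛ g) n = Σ≤ n (λ j → f j * g (n ℕ.∸ j))

one : Series
one zero    = 1ℤ
one (suc _) = 0ℤ

_^ˢ_ : Series → ℕ → Series
f ^ˢ zero  = one
f ^ˢ suc k = f ⊛ (f ^ˢ k)

oneMinusX^ : ℕ → Series
oneMinusX^ k zero = 1ℤ
oneMinusX^ k (suc n) = if does (k ℕ.≟ suc n) then - 1ℤ else 0ℤ

-- the series 1/(1 - x^k) = Σ_j x^{jk}   (used for k ≥ 1)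
geomX^ : ℕ → Series
geomX^ k n = if does (k ∣? n) then 1ℤ else 0ℤ

invPow : ℤ → ℕ → Series
invPow (+ m)    k = geomX^ k ^ˢ m
invPow -[1+ m ] k = oneMinusX^ k ^ˢ suc m

partialProd : ℤ → ℕ → Series
partialProd m zero    = invPow m 1 ⊛ invPow m (2 ^ 0)
partialProd m (suc N) = partialProd m N ⊛ invPow m (2 ^ suc N)

-- c_m(n): coefficient of x^n in (1-x)^{-m} ∏_{i≥0} (1-x^{2^i})^{-m}.
-- Factors with 2^i > n do not affect the coefficient of x^n, and 2^n > n,
-- so truncating the product at i = n gives the exact coefficient.
c : ℤ → ℕ → ℤ
c m n = partialProd m n n

ν₂≡ : ℕ → ℤ → Set
ν₂≡ k a = (+ (2 ^ k) ∣ a) × ¬ (+ (2 ^ suc k) ∣ a)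

-- Write ∇ K s = s − x^K s for multiplication by 1 − x^K.  Applying ∇ K m times undoes
-- multiplication by (1 − x^K)^(−m), so the truncated products for m = 2 and m = −2 are
-- inverse to each other.  The product for m = −2 is obtained from (1 − x)² by applying
-- ∇₁², ∇₂², ∇₄², …, and modulo 8 each ∇_K² turns a series with coefficient pattern
-- 1,4,…,4 | 6,4,…,4 | 1,0,…,0 | 0,… (blocks of length K) into the same pattern with
-- blocks of length 2K; hence c₋₂(n) ≡ 4 for n ≥ 1.  Because 4 · 4 ≡ 0 (mod 8), a series
-- that is 1 + 4x + 4x² + ⋯ mod 8 below degree K has an inverse of the same form, which
-- gives c₂(n) ≡ 4.

module Submission where

open import Defs
open import Data.Bool using (if_then_else_)
open import Data.Integer using (ℤ; +_; -_; _+_; _-_; _*_; 0ℤ; 1ℤ; _%ℕ_; _/ℕ_)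
import Data.Integer.Properties as ℤ
open import Data.Integer.DivMod using (a≡a%ℕn+[a/ℕn]*n; n%ℕd<d)
open import Data.Integer.Divisibility.Signed using (_∣_; divides; _∣?_; ∣-refl; ∣-trans; ∣m∣n⇒∣m+n; ∣m∣n⇒∣m-n; ∣m⇒∣-m; ∣m⇒∣m*n; ∣n⇒∣m*n; ∣⇒∣ᵤ; ∣ᵤ⇒∣)
open import Data.Integer.Tactic.RingSolver using (solve-∀)
open import Data.Nat as ℕ using (ℕ; zero; suc; _∸_; _<_; _≤_; z≤n; s≤s; NonZero)
import Data.Nat.Divisibility as ℕ
open import Data.Nat.Induction using (<-rec)
import Data.Nat.Properties as ℕ
open import Data.Product using (_×_; _,_)
open import Data.Sum using (_⊎_; inj₁; inj₂)
open import Function using (_∘_)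
open import Function.Bundles using (_⇔_; mk⇔)
open import Relation.Binary.PropositionalEquality
open import Relation.Nullary using (¬_; contradiction)
open import Relation.Nullary.Decidable using (True; False; toWitness; toWitnessFalse; from-no; dec-true; dec-false; does-⇔)

Σ≤-cong : ∀ n {f g : ℕ → ℤ} → (∀ {j} → j ≤ n → f j ≡ g j) → Σ≤ n f ≡ Σ≤ n g
Σ≤-cong zero    f≡g = f≡g z≤n
Σ≤-cong (suc n) f≡g = cong₂ _+_ (Σ≤-cong n (f≡g ∘ ℕ.m≤n⇒m≤1+n)) (f≡g ℕ.≤-refl)

Σ≤-distrib-- : ∀ n (f g : ℕ → ℤ) → Σ≤ n (λ j → f j - g j) ≡ Σ≤ n f - Σ≤ n g
Σ≤-distrib-- zero    f g = refl
Σ≤-distrib-- (suc n) f g = begin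
  Σ≤ n (λ j → f j - g j) + (f (suc n) - g (suc n))
    ≡⟨ cong (_+ (f (suc n) - g (suc n))) (Σ≤-distrib-- n f g) ⟩
  Σ≤ n f - Σ≤ n g + (f (suc n) - g (suc n))
    ≡⟨ interchange (Σ≤ n f) (Σ≤ n g) (f (suc n)) (g (suc n)) ⟩
  Σ≤ (suc n) f - Σ≤ (suc n) g ∎
  where
  open ≡-Reasoning
  interchange : ∀ a b c d → a - b + (c - d) ≡ a + c - (b + d)
  interchange = solve-∀

Σ≤-suc : ∀ n (f : ℕ → ℤ) → Σ≤ (suc n) f ≡ f 0 + Σ≤ n (f ∘ suc)
Σ≤-suc zero    f = refl
Σ≤-suc (suc n) f = begin
  Σ≤ (suc n) f + f (2 ℕ.+ n)         ≡⟨ cong (_+ f (2 ℕ.+ n)) (Σ≤-suc n f) ⟩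
  f 0 + Σ≤ n (f ∘ suc) + f (2 ℕ.+ n) ≡⟨ ℤ.+-assoc (f 0) _ _ ⟩
  f 0 + Σ≤ (suc n) (f ∘ suc)         ∎
  where open ≡-Reasoning

Σ≤-reverse : ∀ n (f : ℕ → ℤ) → Σ≤ n f ≡ Σ≤ n (λ j → f (n ∸ j))
Σ≤-reverse zero    f = refl
Σ≤-reverse (suc n) f = begin
  Σ≤ n f + f (suc n)                        ≡⟨ cong (_+ f (suc n)) (Σ≤-reverse n f) ⟩
  Σ≤ n (λ j → f (n ∸ j)) + f (suc n)        ≡⟨ ℤ.+-comm _ (f (suc n)) ⟩
  f (suc n) + Σ≤ n (λ j → f (n ∸ j))        ≡⟨ Σ≤-suc n (λ j → f (suc n ∸ j)) ⟨
  Σ≤ (suc n) (λ j → f (suc n ∸ j))          ∎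
  where open ≡-Reasoning

Σ≤-one* : ∀ n (h : ℕ → ℤ) → Σ≤ n (λ j → one j * h j) ≡ h 0
Σ≤-one* zero    h = ℤ.*-identityˡ (h 0)
Σ≤-one* (suc n) h = trans (cong (_+ 0ℤ) (Σ≤-one* n h)) (ℤ.+-identityʳ (h 0))

⊛-comm : ∀ f g → f ⊛ g ≗ g ⊛ f
⊛-comm f g n = trans (Σ≤-reverse n _) (Σ≤-cong n swap)
  where
  swap : ∀ {j} → j ≤ n → f (n ∸ j) * g (n ∸ (n ∸ j)) ≡ g j * f (n ∸ j)
  swap {j} j≤n rewrite ℕ.m∸[m∸n]≡n j≤n = ℤ.*-comm (f (n ∸ j)) (g j)

⊛-congˡ : ∀ {f f′} g → f ≗ f′ → f ⊛ g ≗ f′ ⊛ g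
⊛-congˡ g f≗f′ n = Σ≤-cong n (λ {j} _ → cong (_* g (n ∸ j)) (f≗f′ j))

⊛-congʳ : ∀ f {g g′} → g ≗ g′ → f ⊛ g ≗ f ⊛ g′
⊛-congʳ f g≗g′ n = Σ≤-cong n (λ {j} _ → cong (f j *_) (g≗g′ (n ∸ j)))

⊛-cong : ∀ {f f′ g g′} → f ≗ f′ → g ≗ g′ → f ⊛ g ≗ f′ ⊛ g′
⊛-cong {f′ = f′} {g} f≗f′ g≗g′ n = trans (⊛-congˡ g f≗f′ n) (⊛-congʳ f′ g≗g′ n)

⊛-identityˡ : ∀ g → one ⊛ g ≗ g
⊛-identityˡ g n = Σ≤-one* n (λ j → g (n ∸ j))

⊛-identityʳ : ∀ g → g ⊛ one ≗ g
⊛-identityʳ g n = trans (⊛-comm g one n) (⊛-identityˡ g n)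

⊛-distribʳ-- : ∀ f g h → (λ n → f n - g n) ⊛ h ≗ (λ n → (f ⊛ h) n - (g ⊛ h) n)
⊛-distribʳ-- f g h n =
  trans (Σ≤-cong n (λ {j} _ → distrib (f j) (g j) (h (n ∸ j))))
        (Σ≤-distrib-- n _ _)
  where
  distrib : ∀ a b c → (a - b) * c ≡ a * c - b * c
  distrib = solve-∀

shift : ℕ → Series → Series
shift zero    s n       = s n
shift (suc K) s zero    = 0ℤ
shift (suc K) s (suc n) = shift K s n

∇ : ℕ → Series → Series
∇ K s n = s n - shift K s n

∇^ : ℕ → ℕ → Series → Series
∇^ K zero    s = s
∇^ K (suc m) s = ∇ K (∇^ K m s)

shift-cong : ∀ K {s t} → s ≗ t → shift K s ≗ shift K t
shift-cong zero    s≗t n       = s≗t n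
shift-cong (suc K) s≗t zero    = refl
shift-cong (suc K) s≗t (suc n) = shift-cong K s≗t n

shift-suc : ∀ K s → shift (suc K) s ≗ shift 1 (shift K s)
shift-suc K s zero    = refl
shift-suc K s (suc n) = refl

shift-< : ∀ K s {n} → n < K → shift K s n ≡ 0ℤ
shift-< (suc K) s {zero}  _         = refl
shift-< (suc K) s {suc n} (s≤s n<K) = shift-< K s n<K

shift-+ : ∀ K s m → shift K s (K ℕ.+ m) ≡ s m
shift-+ zero    s m = refl
shift-+ (suc K) s m = shift-+ K s m

shift-distrib-- : ∀ K s t → shift K (λ n → s n - t n) ≗ (λ n → shift K s n - shift K t n)
shift-distrib-- zero    s t n       = refl
shift-distrib-- (suc K) s t zero    = refl
shift-distrib-- (suc K) s t (suc n) = shift-distrib-- K s t n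

shift₁-⊛ : ∀ s g → shift 1 s ⊛ g ≗ shift 1 (s ⊛ g)
shift₁-⊛ s g zero    = ℤ.*-zeroˡ (g 0)
shift₁-⊛ s g (suc n) = begin
  Σ≤ (suc n) (λ j → shift 1 s j * g (suc n ∸ j))  ≡⟨ Σ≤-suc n _ ⟩
  0ℤ * g (suc n) + (s ⊛ g) n                     ≡⟨ cong (_+ (s ⊛ g) n) (ℤ.*-zeroˡ (g (suc n))) ⟩
  0ℤ + (s ⊛ g) n                                 ≡⟨ ℤ.+-identityˡ _ ⟩
  (s ⊛ g) n                                      ∎
  where open ≡-Reasoning

shift-⊛ : ∀ K s g → shift K s ⊛ g ≗ shift K (s ⊛ g)
shift-⊛ zero    s g n = refl
shift-⊛ (suc K) s g n = begin
  (shift (suc K) s ⊛ g) n        ≡⟨ ⊛-congˡ g (shift-suc K s) n ⟩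
  (shift 1 (shift K s) ⊛ g) n    ≡⟨ shift₁-⊛ (shift K s) g n ⟩
  shift 1 (shift K s ⊛ g) n      ≡⟨ shift-cong 1 (shift-⊛ K s g) n ⟩
  shift 1 (shift K (s ⊛ g)) n    ≡⟨ shift-suc K (s ⊛ g) n ⟨
  shift (suc K) (s ⊛ g) n        ∎
  where open ≡-Reasoning

∇-cong : ∀ K {s t} → s ≗ t → ∇ K s ≗ ∇ K t
∇-cong K s≗t n = cong₂ _-_ (s≗t n) (shift-cong K s≗t n)

∇^-cong : ∀ K m {s t} → s ≗ t → ∇^ K m s ≗ ∇^ K m t
∇^-cong K zero    s≗t = s≗t
∇^-cong K (suc m) s≗t = ∇-cong K (∇^-cong K m s≗t)

∇-⊛ : ∀ K f g → ∇ K f ⊛ g ≗ ∇ K (f ⊛ g)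
∇-⊛ K f g n = trans (⊛-distribʳ-- f (shift K f) g n) (cong (λ x → (f ⊛ g) n - x) (shift-⊛ K f g n))

∇^-⊛ : ∀ K m f g → ∇^ K m f ⊛ g ≗ ∇^ K m (f ⊛ g)
∇^-⊛ K zero    f g n = refl
∇^-⊛ K (suc m) f g n =
  trans (∇-⊛ K (∇^ K m f) g n) (∇-cong K (∇^-⊛ K m f g) n)

⊛-∇^-swap : ∀ K m f g → f ⊛ ∇^ K m g ≗ ∇^ K m f ⊛ g
⊛-∇^-swap K m f g n = begin
  (f ⊛ ∇^ K m g) n    ≡⟨ ⊛-comm f (∇^ K m g) n ⟩
  (∇^ K m g ⊛ f) n    ≡⟨ ∇^-⊛ K m g f n ⟩
  ∇^ K m (g ⊛ f) n    ≡⟨ ∇^-cong K m (⊛-comm g f) n ⟩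
  ∇^ K m (f ⊛ g) n    ≡⟨ ∇^-⊛ K m f g n ⟨
  (∇^ K m f ⊛ g) n    ∎
  where open ≡-Reasoning

data Split (K : ℕ) : ℕ → Set where
  below : ∀ {n} → n < K → Split K n
  above : ∀ m → Split K (K ℕ.+ m)

split : ∀ K n → Split K n
split zero    n       = above n
split (suc K) zero    = below ℕ.z<s
split (suc K) (suc n) with split K n
... | below n<K = below (s≤s n<K)
... | above m   = above m

oneMinusX^-suc : ∀ k n → oneMinusX^ (suc k) (suc n) ≡ - shift k one n
oneMinusX^-suc zero    zero    = refl
oneMinusX^-suc zero    (suc n) = refl
oneMinusX^-suc (suc k) zero    = refl
oneMinusX^-suc (suc k) (suc n) = oneMinusX^-suc k n

oneMinusX^≗∇one : ∀ K .{{_ : NonZero K}} → oneMinusX^ K ≗ ∇ K one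
oneMinusX^≗∇one (suc k) zero    = refl
oneMinusX^≗∇one (suc k) (suc n) = trans (oneMinusX^-suc k n) (sym (ℤ.+-identityˡ _))

geomX^-periodic : ∀ K m → geomX^ K (K ℕ.+ m) ≡ geomX^ K m
geomX^-periodic K m = cong (if_then 1ℤ else 0ℤ) (does-⇔ K∣K+m⇔K∣m (K ℕ.∣? K ℕ.+ m) (K ℕ.∣? m))
  where
  K∣K+m⇔K∣m : K ℕ.∣ K ℕ.+ m ⇔ K ℕ.∣ m
  K∣K+m⇔K∣m = mk⇔ (λ K∣K+m → ℕ.∣m+n∣m⇒∣n K∣K+m ℕ.∣-refl) (ℕ.∣m∣n⇒∣m+n ℕ.∣-refl)

∇-geomX^ : ∀ K .{{_ : NonZero K}} → ∇ K (geomX^ K) ≗ one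
∇-geomX^ K@(suc k) n with split K n
... | below {zero} _ rewrite dec-true (K ℕ.∣? 0) (K ℕ.∣0) = refl
... | below {suc n} n<K rewrite dec-false (K ℕ.∣? suc n) (ℕ.>⇒∤ n<K) | shift-< K (geomX^ K) n<K = refl
... | above m rewrite shift-+ K (geomX^ K) m | geomX^-periodic K m = ℤ.+-inverseʳ (geomX^ K m)

oneMinusX^-^ˢ : ∀ K .{{_ : NonZero K}} m → oneMinusX^ K ^ˢ m ≗ ∇^ K m one
oneMinusX^-^ˢ K zero    n = refl
oneMinusX^-^ˢ K (suc m) n = begin
  (oneMinusX^ K ⊛ (oneMinusX^ K ^ˢ m)) n  ≡⟨ ⊛-congʳ (oneMinusX^ K) (oneMinusX^-^ˢ K m) n ⟩
  (oneMinusX^ K ⊛ ∇^ K m one) n           ≡⟨ ⊛-congˡ (∇^ K m one) (oneMinusX^≗∇one K) n ⟩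
  (∇ K one ⊛ ∇^ K m one) n                ≡⟨ ∇-⊛ K one (∇^ K m one) n ⟩
  ∇ K (one ⊛ ∇^ K m one) n                ≡⟨ ∇-cong K (⊛-identityˡ (∇^ K m one)) n ⟩
  ∇^ K (suc m) one n                      ∎
  where open ≡-Reasoning

∇^-geomX^-^ˢ : ∀ K .{{_ : NonZero K}} m → ∇^ K m (geomX^ K ^ˢ m) ≗ one
∇^-geomX^-^ˢ K zero    n = refl
∇^-geomX^-^ˢ K (suc m) n = begin
  ∇ K (∇^ K m (G ⊛ (G ^ˢ m))) n   ≡⟨ ∇-cong K (∇^-cong K m (⊛-comm G (G ^ˢ m))) n ⟩
  ∇ K (∇^ K m ((G ^ˢ m) ⊛ G)) n   ≡⟨ ∇-cong K (∇^-⊛ K m (G ^ˢ m) G) n ⟨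
  ∇ K (∇^ K m (G ^ˢ m) ⊛ G) n     ≡⟨ ∇-cong K (⊛-congˡ G (∇^-geomX^-^ˢ K m)) n ⟩
  ∇ K (one ⊛ G) n                 ≡⟨ ∇-cong K (⊛-identityˡ G) n ⟩
  ∇ K G n                         ≡⟨ ∇-geomX^ K n ⟩
  one n                           ∎
  where
  open ≡-Reasoning
  G : Series
  G = geomX^ K

invPow-neg≗∇^one : ∀ K .{{_ : NonZero K}} m → invPow (- + m) K ≗ ∇^ K m one
invPow-neg≗∇^one K zero    n = refl
invPow-neg≗∇^one K (suc m) = oneMinusX^-^ˢ K (suc m)

⊛-invPow-neg : ∀ K .{{_ : NonZero K}} m g → g ⊛ invPow (- + m) K ≗ ∇^ K m g
⊛-invPow-neg K m g n = begin
  (g ⊛ invPow (- + m) K) n   ≡⟨ ⊛-congʳ g (invPow-neg≗∇^one K m) n ⟩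
  (g ⊛ ∇^ K m one) n         ≡⟨ ⊛-∇^-swap K m g one n ⟩
  (∇^ K m g ⊛ one) n         ≡⟨ ⊛-identityʳ (∇^ K m g) n ⟩
  ∇^ K m g n                 ∎
  where open ≡-Reasoning

∇^-⊛-invPow-pos : ∀ K .{{_ : NonZero K}} m f → ∇^ K m (f ⊛ invPow (+ m) K) ≗ f
∇^-⊛-invPow-pos K m f n = begin
  ∇^ K m (f ⊛ invPow (+ m) K) n   ≡⟨ ∇^-cong K m (⊛-comm f (invPow (+ m) K)) n ⟩
  ∇^ K m (invPow (+ m) K ⊛ f) n   ≡⟨ ∇^-⊛ K m (invPow (+ m) K) f n ⟨
  (∇^ K m (invPow (+ m) K) ⊛ f) n ≡⟨ ⊛-congˡ f (∇^-geomX^-^ˢ K m) n ⟩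
  (one ⊛ f) n                     ≡⟨ ⊛-identityˡ f n ⟩
  f n                             ∎
  where open ≡-Reasoning

⊛-invPow-inverse : ∀ K .{{_ : NonZero K}} m f g → f ⊛ g ≗ one →
  (f ⊛ invPow (+ m) K) ⊛ (g ⊛ invPow (- + m) K) ≗ one
⊛-invPow-inverse K m f g f⊛g≗one n = begin
  ((f ⊛ P) ⊛ (g ⊛ invPow (- + m) K)) n ≡⟨ ⊛-congʳ (f ⊛ P) (⊛-invPow-neg K m g) n ⟩
  ((f ⊛ P) ⊛ ∇^ K m g) n               ≡⟨ ⊛-∇^-swap K m (f ⊛ P) g n ⟩
  (∇^ K m (f ⊛ P) ⊛ g) n               ≡⟨ ⊛-congˡ g (∇^-⊛-invPow-pos K m f) n ⟩
  (f ⊛ g) n                            ≡⟨ f⊛g≗one n ⟩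
  one n                                ∎
  where
  open ≡-Reasoning
  P : Series
  P = invPow (+ m) K

invPow-inverse : ∀ K .{{_ : NonZero K}} m → invPow (+ m) K ⊛ invPow (- + m) K ≗ one
invPow-inverse K m n = begin
  (invPow (+ m) K ⊛ invPow (- + m) K) n
    ≡⟨ ⊛-cong (⊛-identityˡ (invPow (+ m) K)) (⊛-identityˡ (invPow (- + m) K)) n ⟨
  ((one ⊛ invPow (+ m) K) ⊛ (one ⊛ invPow (- + m) K)) n
    ≡⟨ ⊛-invPow-inverse K m one one (⊛-identityˡ one) n ⟩
  one n ∎
  where open ≡-Reasoning

partialProd-inverse : ∀ m N → partialProd (+ m) N ⊛ partialProd (- + m) N ≗ one
partialProd-inverse m zero    =
  ⊛-invPow-inverse 1 m (invPow (+ m) 1) (invPow (- + m) 1) (invPow-inverse 1 m)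
partialProd-inverse m (suc N) =
  ⊛-invPow-inverse (2 ℕ.^ suc N) {{ℕ.m^n≢0 2 (suc N)}} m
    (partialProd (+ m) N) (partialProd (- + m) N) (partialProd-inverse m N)

infix 4 _≡_[mod_]

record _≡_[mod_] (a b m : ℤ) : Set where
  constructor ≡-mod
  field m∣a-b : m ∣ a - b

module _ {m : ℤ} where

  ≡-mod-reflexive : ∀ {a b} → a ≡ b → a ≡ b [mod m ]
  ≡-mod-reflexive {a} refl = ≡-mod (divides 0ℤ (trans (ℤ.+-inverseʳ a) (sym (ℤ.*-zeroˡ m))))

  ≡-mod-refl : ∀ {a} → a ≡ a [mod m ]
  ≡-mod-refl = ≡-mod-reflexive refl

  ≡-mod-sym : ∀ {a b} → a ≡ b [mod m ] → b ≡ a [mod m ]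
  ≡-mod-sym {a} {b} (≡-mod a≡b) = ≡-mod (subst (m ∣_) (negate a b) (∣m⇒∣-m a≡b))
    where
    negate : ∀ a b → - (a - b) ≡ b - a
    negate = solve-∀

  ≡-mod-trans : ∀ {a b c} → a ≡ b [mod m ] → b ≡ c [mod m ] → a ≡ c [mod m ]
  ≡-mod-trans {a} {b} {c} (≡-mod a≡b) (≡-mod b≡c) =
    ≡-mod (subst (m ∣_) (telescope a b c) (∣m∣n⇒∣m+n a≡b b≡c))
    where
    telescope : ∀ a b c → (a - b) + (b - c) ≡ a - c
    telescope = solve-∀

  +-cong-mod : ∀ {a b c d} → a ≡ b [mod m ] → c ≡ d [mod m ] → a + c ≡ b + d [mod m ]
  +-cong-mod {a} {b} {c} {d} (≡-mod a≡b) (≡-mod c≡d) =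
    ≡-mod (subst (m ∣_) (regroup a b c d) (∣m∣n⇒∣m+n a≡b c≡d))
    where
    regroup : ∀ a b c d → (a - b) + (c - d) ≡ (a + c) - (b + d)
    regroup = solve-∀

  -cong-mod : ∀ {a b c d} → a ≡ b [mod m ] → c ≡ d [mod m ] → a - c ≡ b - d [mod m ]
  -cong-mod {a} {b} {c} {d} (≡-mod a≡b) (≡-mod c≡d) =
    ≡-mod (subst (m ∣_) (regroup a b c d) (∣m∣n⇒∣m-n a≡b c≡d))
    where
    regroup : ∀ a b c d → (a - b) - (c - d) ≡ (a - c) - (b - d)
    regroup = solve-∀

  *-cong-mod : ∀ {a b c d} → a ≡ b [mod m ] → c ≡ d [mod m ] → a * c ≡ b * d [mod m ]
  *-cong-mod {a} {b} {c} {d} (≡-mod a≡b) (≡-mod c≡d) =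
    ≡-mod (subst (m ∣_) (regroup a b c d) (∣m∣n⇒∣m+n (∣m⇒∣m*n c a≡b) (∣n⇒∣m*n b c≡d)))
    where
    regroup : ∀ a b c d → (a - b) * c + b * (c - d) ≡ a * c - b * d
    regroup = solve-∀

  Σ≤-cong-mod : ∀ n {f g : ℕ → ℤ} → (∀ {j} → j ≤ n → f j ≡ g j [mod m ]) →
    Σ≤ n f ≡ Σ≤ n g [mod m ]
  Σ≤-cong-mod zero    f≡g = f≡g z≤n
  Σ≤-cong-mod (suc n) f≡g = +-cong-mod (Σ≤-cong-mod n (f≡g ∘ ℕ.m≤n⇒m≤1+n)) (f≡g ℕ.≤-refl)

  ≡-mod-compute : ∀ {a b} {m∣a-b : True (m ∣? a - b)} → a ≡ b [mod m ]
  ≡-mod-compute {m∣a-b = m∣a-b} = ≡-mod (toWitness m∣a-b)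

  ∣-resp-≡-mod : ∀ {d a b} → a ≡ b [mod m ] → d ∣ m → d ∣ b → d ∣ a
  ∣-resp-≡-mod {d} {a} {b} (≡-mod a≡b) d∣m d∣b =
    subst (d ∣_) (cancel a b) (∣m∣n⇒∣m+n (∣-trans d∣m a≡b) d∣b)
    where
    cancel : ∀ a b → (a - b) + b ≡ a
    cancel = solve-∀

  ≢-mod-compute : ∀ {a b} {m∤a-b : False (m ∣? a - b)} → ¬ (a ≡ b [mod m ])
  ≢-mod-compute {m∤a-b = m∤a-b} (≡-mod m∣a-b) = toWitnessFalse m∤a-b m∣a-b

∇²-shift : ∀ K s n → ∇^ K 2 s n ≡ (s n - shift K s n) - (shift K s n - shift K (shift K s) n)
∇²-shift K s n = cong (λ x → s n - shift K s n - x) (shift-distrib-- K s (shift K s) n)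

∇²-< : ∀ K s {n} → n < K → ∇^ K 2 s n ≡ s n
∇²-< K s {n} n<K = begin
  ∇^ K 2 s n
    ≡⟨ ∇²-shift K s n ⟩
  (s n - shift K s n) - (shift K s n - shift K (shift K s) n)
    ≡⟨ cong₂ (λ x y → (s n - x) - (x - y)) (shift-< K s n<K) (shift-< K (shift K s) n<K) ⟩
  (s n - 0ℤ) - 0ℤ
    ≡⟨ ℤ.+-identityʳ _ ⟩
  s n - 0ℤ
    ≡⟨ ℤ.+-identityʳ _ ⟩
  s n ∎
  where open ≡-Reasoning

∇²-+ : ∀ K s {m} → m < K → ∇^ K 2 s (K ℕ.+ m) ≡ (s (K ℕ.+ m) - s m) - (s m - 0ℤ)
∇²-+ K s {m} m<K = begin
  ∇^ K 2 s (K ℕ.+ m)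
    ≡⟨ ∇²-shift K s (K ℕ.+ m) ⟩
  (s (K ℕ.+ m) - shift K s (K ℕ.+ m)) - (shift K s (K ℕ.+ m) - shift K (shift K s) (K ℕ.+ m))
    ≡⟨ cong₂ (λ x y → (s (K ℕ.+ m) - x) - (x - y)) (shift-+ K s m) (shift-+ K (shift K s) m) ⟩
  (s (K ℕ.+ m) - s m) - (s m - shift K s m)
    ≡⟨ cong (λ x → (s (K ℕ.+ m) - s m) - (s m - x)) (shift-< K s m<K) ⟩
  (s (K ℕ.+ m) - s m) - (s m - 0ℤ) ∎
  where open ≡-Reasoning

∇²-+-+ : ∀ K s m →
  ∇^ K 2 s (K ℕ.+ (K ℕ.+ m)) ≡ (s (K ℕ.+ (K ℕ.+ m)) - s (K ℕ.+ m)) - (s (K ℕ.+ m) - s m)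
∇²-+-+ K s m = trans (∇²-shift K s _)
  (cong₂ (λ x y → (s (K ℕ.+ (K ℕ.+ m)) - x) - (x - y))
    (shift-+ K s (K ℕ.+ m))
    (trans (shift-+ K (shift K s) (K ℕ.+ m)) (shift-+ K s m)))

second-difference-mod : ∀ {m x a b c a′ b′ c′ r} → x ≡ (a - b) - (b - c) →
  a ≡ a′ [mod m ] → b ≡ b′ [mod m ] → c ≡ c′ [mod m ] →
  {m∣d-r : True (m ∣? ((a′ - b′) - (b′ - c′)) - r)} → x ≡ r [mod m ]
second-difference-mod refl a≡a′ b≡b′ c≡c′ {m∣d-r} =
  ≡-mod-trans (-cong-mod (-cong-mod a≡a′ b≡b′) (-cong-mod b≡b′ c≡c′)) (≡-mod-compute {m∣a-b = m∣d-r})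

then4s : ℤ → ℕ → ℤ
then4s a zero    = a
then4s a (suc _) = + 4

record Profile (K : ℕ) (A : Series) : Set where
  field
    block₀ : ∀ {m} → m < K → A m ≡ then4s (+ 1) m [mod + 8 ]
    block₁ : ∀ {m} → m < K → A (K ℕ.+ m) ≡ then4s (+ 6) m [mod + 8 ]
    block₂ : ∀ {m} → m < K → A (K ℕ.+ (K ℕ.+ m)) ≡ one m [mod + 8 ]
    tail   : ∀ m → A (K ℕ.+ (K ℕ.+ (K ℕ.+ m))) ≡ 0ℤ [mod + 8 ]

profile-step : ∀ K .{{_ : NonZero K}} {A} → Profile K A → Profile (K ℕ.+ K) (∇^ K 2 A)
profile-step K@(suc k) {A} P = record
  { block₀ = block₀′ ; block₁ = block₁′ ; block₂ = block₂′ ; tail = tail′ }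
  where
  open Profile P

  A′ : Series
  A′ = ∇^ K 2 A

  0<K : 0 < K
  0<K = ℕ.z<s

  +K+K : ∀ i → (K ℕ.+ K) ℕ.+ i ≡ K ℕ.+ (K ℕ.+ i)
  +K+K i = ℕ.+-assoc K K i

  reindex : ∀ {i j r} → i ≡ j → A′ j ≡ r [mod + 8 ] → A′ i ≡ r [mod + 8 ]
  reindex refl A′j≡r = A′j≡r

  block₀′ : ∀ {m} → m < K ℕ.+ K → A′ m ≡ then4s (+ 1) m [mod + 8 ]
  block₀′ {m} m<2K with split K m
  ... | below m<K   = ≡-mod-trans (≡-mod-reflexive (∇²-< K A m<K)) (block₀ m<K)
  ... | above zero  = second-difference-mod (∇²-+ K A 0<K) (block₁ 0<K) (block₀ 0<K) (≡-mod-refl {a = 0ℤ})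
  ... | above (suc j) = second-difference-mod (∇²-+ K A j<K) (block₁ j<K) (block₀ j<K) (≡-mod-refl {a = 0ℤ})
    where
    j<K : suc j < K
    j<K = ℕ.+-cancelˡ-< K _ _ m<2K

  block₁′ : ∀ {m} → m < K ℕ.+ K → A′ (K ℕ.+ K ℕ.+ m) ≡ then4s (+ 6) m [mod + 8 ]
  block₁′ {m} m<2K with split K m
  ... | below {zero} _ = reindex (+K+K 0)
    (second-difference-mod (∇²-+-+ K A 0) (block₂ 0<K) (block₁ 0<K) (block₀ 0<K))
  ... | below {suc j} j<K = reindex (+K+K (suc j))
    (second-difference-mod (∇²-+-+ K A (suc j)) (block₂ j<K) (block₁ j<K) (block₀ j<K))
  ... | above zero = reindex (+K+K (K ℕ.+ 0))
    (second-difference-mod (∇²-+-+ K A (K ℕ.+ 0)) (tail 0) (block₂ 0<K) (block₁ 0<K))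
  ... | above (suc j) = reindex (+K+K (K ℕ.+ suc j))
    (second-difference-mod (∇²-+-+ K A (K ℕ.+ suc j)) (tail (suc j)) (block₂ j<K) (block₁ j<K))
    where
    j<K : suc j < K
    j<K = ℕ.+-cancelˡ-< K _ _ m<2K

  block₂′ : ∀ {m} → m < K ℕ.+ K → A′ (K ℕ.+ K ℕ.+ (K ℕ.+ K ℕ.+ m)) ≡ one m [mod + 8 ]
  block₂′ {m} m<2K = reindex (trans (+K+K _) (cong (λ i → K ℕ.+ (K ℕ.+ i)) (+K+K m))) (via-tails m<2K)
    where
    via-tails : ∀ {m} → m < K ℕ.+ K → A′ (K ℕ.+ (K ℕ.+ (K ℕ.+ (K ℕ.+ m)))) ≡ one m [mod + 8 ]
    via-tails {m} m<2K with split K m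
    ... | below {zero} _ = second-difference-mod (∇²-+-+ K A (K ℕ.+ (K ℕ.+ 0)))
      (tail (K ℕ.+ 0)) (tail 0) (block₂ 0<K)
    ... | below {suc j} j<K = second-difference-mod (∇²-+-+ K A (K ℕ.+ (K ℕ.+ suc j)))
      (tail (K ℕ.+ suc j)) (tail (suc j)) (block₂ j<K)
    ... | above j = second-difference-mod (∇²-+-+ K A (K ℕ.+ (K ℕ.+ (K ℕ.+ j))))
      (tail (K ℕ.+ (K ℕ.+ j))) (tail (K ℕ.+ j)) (tail j)

  tail′ : ∀ m → A′ (K ℕ.+ K ℕ.+ (K ℕ.+ K ℕ.+ (K ℕ.+ K ℕ.+ m))) ≡ 0ℤ [mod + 8 ]
  tail′ m = reindex (trans (+K+K _) (cong (λ i → K ℕ.+ (K ℕ.+ i))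
                     (trans (+K+K _) (cong (λ i → K ℕ.+ (K ℕ.+ i)) (+K+K m)))))
    (second-difference-mod (∇²-+-+ K A (K ℕ.+ (K ℕ.+ (K ℕ.+ (K ℕ.+ m)))))
      (tail (K ℕ.+ (K ℕ.+ (K ℕ.+ m)))) (tail (K ℕ.+ (K ℕ.+ m))) (tail (K ℕ.+ m)))

inverse-then4s : ∀ {K} g a → g ⊛ a ≗ one →
  (∀ {m} → m < K → a m ≡ then4s (+ 1) m [mod + 8 ]) →
  ∀ {n} → n < K → g n ≡ then4s (+ 1) n [mod + 8 ]
inverse-then4s {K} g a g⊛a≗one a≡ {n} = <-rec P step n
  where
  P : ℕ → Set
  P n = n < K → g n ≡ then4s (+ 1) n [mod + 8 ]

  g≡g*a₀ : ∀ {n} → 0 < K → g n ≡ g n * a 0 [mod + 8 ]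
  g≡g*a₀ {n} 0<K =
    ≡-mod-trans (≡-mod-reflexive (sym (ℤ.*-identityʳ (g n))))
                (*-cong-mod (≡-mod-refl {a = g n}) (≡-mod-sym (a≡ 0<K)))

  term : ∀ {n} → suc n < K → (∀ {j} → j < suc n → P j) →
    ∀ {j} → j ≤ n → g j * a (suc n ∸ j) ≡ one j * + 4 [mod + 8 ]
  term {n} n<K rec {j} j≤n = ≡-mod-trans (*-cong-mod (rec (s≤s j≤n) j<K) a≡4) (four-then4s j)
    where
    j<K : j < K
    j<K = ℕ.<-trans (s≤s j≤n) n<K
    a≡4 : a (suc n ∸ j) ≡ + 4 [mod + 8 ]
    a≡4 rewrite ℕ.+-∸-assoc 1 j≤n = a≡ (ℕ.≤-<-trans (s≤s (ℕ.m∸n≤m n j)) n<K)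
    four-then4s : ∀ j → then4s (+ 1) j * + 4 ≡ one j * + 4 [mod + 8 ]
    four-then4s zero    = ≡-mod-refl
    four-then4s (suc j) = ≡-mod-compute

  step : ∀ n → (∀ {j} → j < n → P j) → P n
  step zero    _   0<K = ≡-mod-trans (g≡g*a₀ 0<K) (≡-mod-reflexive (g⊛a≗one 0))
  step (suc n) rec n<K =
    ≡-mod-trans (g≡g*a₀ 0<K) (≡-mod-trans (≡-mod-reflexive X≡-S) -S≡4)
    where
    0<K : 0 < K
    0<K = ℕ.<-trans ℕ.z<s n<K
    S X : ℤ
    S = Σ≤ n (λ j → g j * a (suc n ∸ j))
    X = g (suc n) * a 0
    S+X≡0 : S + X ≡ 0ℤ
    S+X≡0 = trans (cong (λ i → S + g (suc n) * a i) (sym (ℕ.n∸n≡0 n))) (g⊛a≗one (suc n))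
    X≡-S : X ≡ 0ℤ - S
    X≡-S = trans (cancel S X) (cong (λ y → y - S) S+X≡0)
      where
      cancel : ∀ S X → X ≡ (S + X) - S
      cancel = solve-∀
    -S≡4 : 0ℤ - S ≡ + 4 [mod + 8 ]
    -S≡4 = ≡-mod-trans (-cong-mod (≡-mod-refl {a = 0ℤ}) S≡4) ≡-mod-compute
      where
      S≡4 : S ≡ + 4 [mod + 8 ]
      S≡4 = ≡-mod-trans (Σ≤-cong-mod n (term n<K rec)) (≡-mod-reflexive (⊛-identityˡ (λ _ → + 4) n))

profile-cong : ∀ {K A B} → A ≗ B → Profile K A → Profile K B
profile-cong {K} A≗B P = record
  { block₀ = λ m<K → ≡-mod-trans (≡-mod-reflexive (sym (A≗B _))) (block₀ m<K)
  ; block₁ = λ m<K → ≡-mod-trans (≡-mod-reflexive (sym (A≗B _))) (block₁ m<K)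
  ; block₂ = λ m<K → ≡-mod-trans (≡-mod-reflexive (sym (A≗B _))) (block₂ m<K)
  ; tail   = λ m → ≡-mod-trans (≡-mod-reflexive (sym (A≗B _))) (tail m)
  }
  where open Profile P

profile-[1-x]² : Profile 1 (∇^ 1 2 one)
profile-[1-x]² = record
  { block₀ = λ { {zero} _ → ≡-mod-compute ; {suc _} (s≤s ()) }
  ; block₁ = λ { {zero} _ → ≡-mod-compute ; {suc _} (s≤s ()) }
  ; block₂ = λ { {zero} _ → ≡-mod-compute ; {suc _} (s≤s ()) }
  ; tail   = λ _ → ≡-mod-compute
  }

profile-partialProd : ∀ N → Profile (2 ℕ.^ suc N) (partialProd (- + 2) N)
profile-partialProd zero = profile-cong partialProd₀≗ (profile-step 1 profile-[1-x]²)
  where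
  partialProd₀≗ : ∇^ 1 2 (∇^ 1 2 one) ≗ partialProd (- + 2) 0
  partialProd₀≗ n =
    sym (trans (⊛-invPow-neg 1 2 (invPow (- + 2) 1) n) (∇^-cong 1 2 (invPow-neg≗∇^one 1 2) n))
profile-partialProd (suc N) =
  subst (λ L → Profile L (partialProd (- + 2) (suc N))) (cong (K ℕ.+_) (sym (ℕ.+-identityʳ K)))
    (profile-cong (λ n → sym (⊛-invPow-neg K 2 (partialProd (- + 2) N) n))
      (profile-step K (profile-partialProd N)))
  where
  K : ℕ
  K = 2 ℕ.^ suc N
  instance
    K≢0 : NonZero K
    K≢0 = ℕ.m^n≢0 2 (suc N)

residue≡4 : ∀ {r} → r < 8 → + r ≡ + 4 [mod + 8 ] → r ≡ 4
residue≡4 {0} _ r≡4 = contradiction r≡4 ≢-mod-compute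
residue≡4 {1} _ r≡4 = contradiction r≡4 ≢-mod-compute
residue≡4 {2} _ r≡4 = contradiction r≡4 ≢-mod-compute
residue≡4 {3} _ r≡4 = contradiction r≡4 ≢-mod-compute
residue≡4 {4} _ _   = refl
residue≡4 {5} _ r≡4 = contradiction r≡4 ≢-mod-compute
residue≡4 {6} _ r≡4 = contradiction r≡4 ≢-mod-compute
residue≡4 {7} _ r≡4 = contradiction r≡4 ≢-mod-compute
residue≡4 {suc (suc (suc (suc (suc (suc (suc (suc _)))))))}
  (s≤s (s≤s (s≤s (s≤s (s≤s (s≤s (s≤s (s≤s ()))))))))

≡-mod-%ℕ : ∀ x n .{{_ : NonZero n}} → x ≡ + (x %ℕ n) [mod + n ]
≡-mod-%ℕ x n = ≡-mod (divides (x /ℕ n) (trans (cong (_- r) (a≡a%ℕn+[a/ℕn]*n x n)) (cancel r (x /ℕ n * + n))))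
  where
  r : ℤ
  r = + (x %ℕ n)
  cancel : ∀ r q → (r + q) - r ≡ q
  cancel = solve-∀

≡4[mod8]⇒%8≡4×ν₂≡2 : ∀ {x} → x ≡ + 4 [mod + 8 ] → (x %ℕ 8 ≡ 4) × ν₂≡ 2 x
≡4[mod8]⇒%8≡4×ν₂≡2 {x} x≡4 = residue≡4 (n%ℕd<d x 8) (≡-mod-trans (≡-mod-sym (≡-mod-%ℕ x 8)) x≡4)
  , ∣⇒∣ᵤ (∣-resp-≡-mod x≡4 (divides (+ 2) refl) ∣-refl)
  , λ 8∣x → from-no (+ 8 ∣? + 4) (∣-resp-≡-mod (≡-mod-sym x≡4) ∣-refl (∣ᵤ⇒∣ 8∣x))

n<2^n : ∀ n → n < 2 ℕ.^ n
n<2^n zero    = ℕ.z<s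
n<2^n (suc n) = ℕ.+-mono-≤ (ℕ.m^n>0 2 n) (ℕ.≤-trans (n<2^n n) (ℕ.m≤m+n _ 0))

n<2^[1+n] : ∀ n → n < 2 ℕ.^ suc n
n<2^[1+n] n = ℕ.<-≤-trans (n<2^n n) (ℕ.m≤m+n _ _)

corollary2p3 : (m : ℤ) → (m ≡ + 2 ⊎ m ≡ - (+ 2)) → (n : ℕ) → 1 ≤ n →
    (c m n %ℕ 8 ≡ 4) × ν₂≡ 2 (c m n)
corollary2p3 _ (inj₁ refl) n@(suc _) _ =
  ≡4[mod8]⇒%8≡4×ν₂≡2 (inverse-then4s (partialProd (+ 2) n) (partialProd (- + 2) n)
    (partialProd-inverse 2 n) (Profile.block₀ (profile-partialProd n)) (n<2^[1+n] n))
corollary2p3 _ (inj₂ refl) n@(suc _) _ =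
  ≡4[mod8]⇒%8≡4×ν₂≡2 (Profile.block₀ (profile-partialProd n) (n<2^[1+n] n))
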